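{- Fix positive integers $n$ and $m\in\{1,\dots,\binom{n}{2}\}$. Among all sequences $\mathbf{d}=(d_1,\dots,d_n)$ of non-negative integers with $\sum_i d_i=2m$, the quantity $g(\mathbf{d})$ is maximized when $\mathbf{d}$ is balanced; that is, $$\max\Big\{g(\mathbf{d}):\sum_i d_i=2m\Big\}=g(\hat{\mathbf{d}}),$$ where $\hat{\mathbf{d}}$ is the sequence (unique up to order) with sum $2m$ whose entries all lie in $\{\lfloor 2m/n\rfloor,\lceil 2m/n\rceil\}$.
   Context: For a sequence $\mathbf{d}=(d_1,\dots,d_n)$, $g(\mathbf{d})$ denotes the number of (simple) graphs on vertex set $[n]=\{1,\dots,n\}$ in which vertex $i$ has degree $d_i$ for every $i$. A sequence is balanced if $|d_i-d_j|\le 1$ for all $i,j$. -}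

module Defs where

open import Data.Nat using (ℕ; zero; suc; _+_; _*_; _≡ᵇ_; _<ᵇ_; _≤_)
open import Data.Bool using (Bool; true; false; _∧_; _∨_; if_then_else_)
open import Data.Fin using (Fin; toℕ)
open import Data.List using (List; []; _∷_; map; _++_; concatMap; allFin; length; filterᵇ; tabulate)
open import Data.Nat.ListAction using (sum)
open import Data.Product using (_×_; _,_; proj₁; proj₂)

possibleEdges : (n : ℕ) → List (Fin n × Fin n)
possibleEdges n =
  concatMap (λ i → map (λ j → (i , j)) (filterᵇ (λ j → toℕ i <ᵇ toℕ j) (allFin n))) (allFin n)

-- all sublists (subsets, since the list has no repetitions)
sublists : {A : Set} → List A → List (List A)
sublists []       = [] ∷ []
sublists (x ∷ xs) = map (x ∷_) (sublists xs) ++ sublists xs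

-- a simple graph on [n] is a set of possible edges; enumerate them all
allGraphs : (n : ℕ) → List (List (Fin n × Fin n))
allGraphs n = sublists (possibleEdges n)

degree : {n : ℕ} → List (Fin n × Fin n) → Fin n → ℕ
degree E v = length (filterᵇ (λ e → (toℕ (proj₁ e) ≡ᵇ toℕ v) ∨ (toℕ (proj₂ e) ≡ᵇ toℕ v)) E)

allᵇ : {A : Set} → (A → Bool) → List A → Bool
allᵇ p []       = true
allᵇ p (x ∷ xs) = p x ∧ allᵇ p xs

hasDegrees : {n : ℕ} → (Fin n → ℕ) → List (Fin n × Fin n) → Bool
hasDegrees {n} d E = allᵇ (λ v → degree E v ≡ᵇ d v) (allFin n)

g : {n : ℕ} → (Fin n → ℕ) → ℕ
g {n} d = length (filterᵇ (hasDegrees d) (allGraphs n))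

degSum : {n : ℕ} → (Fin n → ℕ) → ℕ
degSum {n} d = sum (tabulate d)

Balanced : {n : ℕ} → (Fin n → ℕ) → Set
Balanced d = ∀ i j → d i ≤ suc (d j)

-- Moving one unit of degree from a vertex a to a vertex b with d b < d a never
-- decreases g. Starting from d, repeatedly move a unit from a vertex above d̂ to one
-- below it: balancedness of d̂ guarantees that the first has the larger degree, and
-- each move lowers the total excess over d̂, so d̂ is reached with g only increasing.
--
-- For the one-step inequality, g d is the number of sublists of the edges of Kₙ whose
-- incidence vectors sum to d. The transposition (a b) fixes every edge meeting both or
-- neither of a and b, and exchanges {a,v} with {b,v}; so up to permutation the edge
-- list consists of fixed edges and exchanged pairs, and the inequality follows by
-- induction over such a list, together with the invariance of the count under (a b).

module Submission where

open import Defs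
open import Data.Nat using (ℕ; _*_; _≤_; _≥_)
open import Data.Nat.Combinatorics using (_C_)
open import Data.Fin using (Fin)
open import Relation.Binary.PropositionalEquality using (_≡_)

open import Data.Bool using (Bool; true; false; T; if_then_else_; _∧_; _∨_; not)
open import Data.Bool.Properties using (T-∧; T-≡; ∨-comm)
open import Data.Empty using (⊥-elim)
open import Data.Fin using (zero; suc; toℕ)
open import Data.Fin.Permutation.Components using (transpose)
open import Data.Fin.Properties using (_≟_; all?; ¬∀⟶∃¬; toℕ<n; toℕ-injective)
open import Data.Integer as ℤ using (ℤ; +_; 0ℤ; 1ℤ; _-_) renaming (_+_ to _+ℤ_)
open import Data.Integer.Properties using (pos-+)
open import Data.Integer.Tactic.RingSolver using (solve-∀)
open import Data.List using (List; []; _∷_; _++_; [_]; map; filterᵇ; length; concatMap; allFin; tabulate)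
open import Data.List.Membership.Propositional using (find)
open import Data.List.Membership.Propositional.Properties using (∈-∃++)
open import Data.List.Properties using (length-++; filter-++; map-tabulate; map-cong; tabulate-cong)
open import Data.List.Relation.Binary.Permutation.Propositional as ↭ using (_↭_; ↭-refl; ↭-trans)
open import Data.List.Relation.Binary.Permutation.Propositional.Properties using (↭-length) renaming (map⁺ to ↭-map⁺; shift to ↭-shift)
open import Data.List.Relation.Unary.All using (All; []; _∷_)
open import Data.List.Relation.Unary.All.Properties using (tabulate⁺; tabulate⁻)
open import Data.List.Relation.Unary.Any using (Any; here; there)
open import Data.Nat using (zero; suc; pred; _+_; _∸_; _<_; _≤?_; _≡ᵇ_; _<ᵇ_; _⊓_; _⊔_; z≤n; s≤s; >-nonZero)
open import Data.Nat.ListAction using (sum)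
open import Data.Nat.ListAction.Properties using (sum-↭)
open import Data.Nat.Properties
  using (+-comm; +-suc; +-identityʳ; *-identityʳ; +-cancelˡ-≡; suc-injective; suc-pred;
         ≤-refl; ≤-trans; ≤-reflexive; ≤-total; n≤1+n; <⇒≤; <-trans; <-irrefl; <-asym; ≰⇒>; m≤n⇒m<n∨m≡n;
         +-mono-≤; +-mono-<-≤; +-mono-≤-<; ≡ᵇ⇒≡; ≡⇒≡ᵇ; <ᵇ⇒<;
         m≤n⇒m⊓n≡m; m≤n⇒m⊔n≡n; m≥n⇒m⊓n≡n; m≥n⇒m⊔n≡m; ⊓-comm; ⊔-comm; ⊔-lub;
         m+[n∸m]≡n; m≤n⇒m∸n≡0; m<n⇒0<n∸m; 0∸n≡0; pred[m∸n]≡m∸[1+n]; +-commutativeSemigroup; module ≤-Reasoning)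
  renaming (_≟_ to _≟ℕ_)
open import Algebra.Properties.CommutativeSemigroup +-commutativeSemigroup using (interchange)
open import Data.Product as Product using (_×_; _,_; proj₁; proj₂; swap; ∃-syntax)
open import Data.Product.Properties using (,-injective; ≡-dec)
open import Data.Sum using (_⊎_; inj₁; inj₂; [_,_]′)
open import Data.Unit using (tt)
open import Data.Vec.Functional using (Vector; updateAt)
open import Data.Vec.Functional.Properties using (updateAt-updates; updateAt-minimal)
import Data.Vec.Functional.Relation.Binary.Pointwise.Properties as Pointwise
open import Function using (id; _∘_; _⇔_; mk⇔; Equivalence)
open import Level using (Level) renaming (_⊔_ to _⊔ˡ_)
open import Relation.Binary using (Rel; IsEquivalence; DecSetoid)
open import Relation.Binary.Definitions using (DecidableEquality)
import Relation.Binary.Construct.On as On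
open import Relation.Binary.PropositionalEquality as ≡
  using (_≢_; _≗_; refl; cong; cong₂; subst; subst₂; module ≡-Reasoning)
open import Relation.Binary.PropositionalEquality.Properties using (decSetoid)
open import Relation.Nullary using (¬_; Dec; yes; no; does)
open import Relation.Nullary.Decidable using (does-⇔; dec-true; dec-false; T?)
open import Relation.Unary using (Decidable)

private variable
  ℓ₁ ℓ₂ ℓ₃ ℓ₄ : Level
  n : ℕ

iverson : Bool → ℕ
iverson b = if b then 1 else 0

count : {A : Set ℓ₁} → (A → Bool) → List A → ℕ
count p = length ∘ filterᵇ p

module _ {A : Set ℓ₁} (p : A → Bool) where

  count-∷ : ∀ x xs → count p (x ∷ xs) ≡ iverson (p x) + count p xs
  count-∷ x xs with p x
  ... | true  = refl
  ... | false = refl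

  count≡sum : ∀ xs → count p xs ≡ sum (map (iverson ∘ p) xs)
  count≡sum []       = refl
  count≡sum (x ∷ xs) = ≡.trans (count-∷ x xs) (cong (_+_ (iverson (p x))) (count≡sum xs))

  count-++ : ∀ xs ys → count p (xs ++ ys) ≡ count p xs + count p ys
  count-++ xs ys = ≡.trans (cong length (filter-++ _ xs ys)) (length-++ (filterᵇ p xs))

  count-↭ : ∀ {xs ys} → xs ↭ ys → count p xs ≡ count p ys
  count-↭ {xs} {ys} xs↭ys = begin
    count p xs                    ≡⟨ count≡sum xs ⟩
    sum (map (iverson ∘ p) xs)    ≡⟨ sum-↭ (↭-map⁺ _ xs↭ys) ⟩
    sum (map (iverson ∘ p) ys)    ≡⟨ count≡sum ys ⟨
    count p ys                    ∎
    where open ≡-Reasoning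

  count-pos⇒Any : ∀ {xs} → 0 < count p xs → Any (T ∘ p) xs
  count-pos⇒Any {x ∷ xs} pos with p x in px
  ... | true  = here (subst T (≡.sym px) _)
  ... | false = there (count-pos⇒Any pos)

count-map : {A : Set ℓ₁} {B : Set ℓ₂} (p : B → Bool) (f : A → B) (xs : List A) →
            count p (map f xs) ≡ count (p ∘ f) xs
count-map p f []       = refl
count-map p f (x ∷ xs) = begin
  count p (f x ∷ map f xs)                 ≡⟨ count-∷ p (f x) (map f xs) ⟩
  iverson (p (f x)) + count p (map f xs)   ≡⟨ cong (_+_ (iverson (p (f x)))) (count-map p f xs) ⟩
  iverson (p (f x)) + count (p ∘ f) xs     ≡⟨ count-∷ (p ∘ f) x xs ⟨
  count (p ∘ f) (x ∷ xs)                   ∎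
  where open ≡-Reasoning

count-≗ : {A : Set ℓ₁} {p q : A → Bool} → p ≗ q → ∀ xs → count p xs ≡ count q xs
count-≗ p≗q []       = refl
count-≗ {p = p} {q} p≗q (x ∷ xs) = begin
  count p (x ∷ xs)            ≡⟨ count-∷ p x xs ⟩
  iverson (p x) + count p xs  ≡⟨ cong₂ (λ b c → iverson b + c) (p≗q x) (count-≗ p≗q xs) ⟩
  iverson (q x) + count q xs  ≡⟨ count-∷ q x xs ⟨
  count q (x ∷ xs)            ∎
  where open ≡-Reasoning

count-false : {A : Set ℓ₁} (xs : List A) → count (λ _ → false) xs ≡ 0
count-false []       = refl
count-false (x ∷ xs) = count-false xs

count-filterᵇ : {A : Set ℓ₁} (p q : A → Bool) (xs : List A) →
                count q (filterᵇ p xs) ≡ count (λ x → p x ∧ q x) xs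
count-filterᵇ p q []       = refl
count-filterᵇ p q (x ∷ xs) rewrite count-∷ (λ x → p x ∧ q x) x xs with p x
... | true  = ≡.trans (count-∷ q x (filterᵇ p xs)) (cong (_+_ (iverson (q x))) (count-filterᵇ p q xs))
... | false = count-filterᵇ p q xs

count-const-∧ : {A : Set ℓ₁} (c : Bool) (p : A → Bool) (xs : List A) →
                count (λ x → c ∧ p x) xs ≡ iverson c * count p xs
count-const-∧ true  p xs = ≡.sym (+-identityʳ (count p xs))
count-const-∧ false p xs = count-false xs

count-concatMap : {A : Set ℓ₁} {B : Set ℓ₂} (p : B → Bool) (f : A → List B) (xs : List A) →
                  count p (concatMap f xs) ≡ sum (map (count p ∘ f) xs)
count-concatMap p f []       = refl
count-concatMap p f (x ∷ xs) =
  ≡.trans (count-++ p (f x) (concatMap f xs)) (cong (_+_ (count p (f x))) (count-concatMap p f xs))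

T-does : {P : Set ℓ₁} (P? : Dec P) → T (does P?) ⇔ P
T-does (yes p) = mk⇔ (λ _ → p) (λ _ → tt)
T-does (no ¬p) = mk⇔ (λ ()) ¬p

T-⇔⇒≡ : ∀ {b c} → (T b ⇔ T c) → b ≡ c
T-⇔⇒≡ {b} {c} T⇔T = does-⇔ T⇔T (T? b) (T? c)

T-allᵇ : ∀ {A : Set} (p : A → Bool) xs → T (allᵇ p xs) ⇔ All (T ∘ p) xs
T-allᵇ p []       = mk⇔ (λ _ → []) (λ _ → tt)
T-allᵇ p (x ∷ xs) = mk⇔
  (λ t → let px , pxs = Equivalence.to T-∧ t in px ∷ Equivalence.to (T-allᵇ p xs) pxs)
  (λ { (px ∷ pxs) → Equivalence.from T-∧ (px , Equivalence.from (T-allᵇ p xs) pxs) })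

allᵇ-allFin : {P : Fin n → Set ℓ₁} (P? : Decidable P) → allᵇ (does ∘ P?) (allFin n) ≡ does (all? P?)
allᵇ-allFin {n = n} P? = does-⇔ (mk⇔
  (λ t v → Equivalence.to (T-does (P? v)) (tabulate⁻ (Equivalence.to all⇔ t) v))
  (λ ∀P → Equivalence.from all⇔ (tabulate⁺ (λ v → Equivalence.from (T-does (P? v)) (∀P v)))))
  (T? _) (all? P?)
  where
  all⇔ : T (allᵇ (does ∘ P?) (allFin n)) ⇔ All (T ∘ does ∘ P?) (allFin n)
  all⇔ = T-allᵇ (does ∘ P?) (allFin n)

count-tabulate : {A : Set ℓ₁} (p : A → Bool) (f : Fin n → A) →
                 count p (tabulate f) ≡ count (p ∘ f) (allFin n)
count-tabulate p f = ≡.trans (cong (count p) (≡.sym (map-tabulate id f))) (count-map p f (allFin _))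

count-toℕ-allFin : ∀ y → y < n → count (λ j → toℕ j ≡ᵇ y) (allFin n) ≡ 1
count-toℕ-allFin {n = suc n} y y<n = begin
  count ((_≡ᵇ y) ∘ toℕ) (allFin (suc n))
    ≡⟨ count-∷ ((_≡ᵇ y) ∘ toℕ) zero (tabulate {n = n} suc) ⟩
  iverson (0 ≡ᵇ y) + count ((_≡ᵇ y) ∘ toℕ) (tabulate {n = n} suc)
    ≡⟨ cong (_+_ (iverson (0 ≡ᵇ y))) (count-tabulate {n = n} ((_≡ᵇ y) ∘ toℕ) suc) ⟩
  iverson (0 ≡ᵇ y) + count ((_≡ᵇ y) ∘ toℕ ∘ suc) (allFin n)
    ≡⟨ rest y y<n ⟩
  1 ∎
  where
  open ≡-Reasoning
  rest : ∀ y → y < suc n → iverson (0 ≡ᵇ y) + count (λ j → suc (toℕ j) ≡ᵇ y) (allFin n) ≡ 1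
  rest zero    _         = cong suc (count-false (allFin n))
  rest (suc y) (s≤s y<n) = count-toℕ-allFin y y<n

-- Lists paired up by an involution

data Paired {A : Set ℓ₁} (_≈_ : Rel A ℓ₂) (τ : A → A) : List A → Set (ℓ₁ ⊔ˡ ℓ₂) where
  []    : Paired _≈_ τ []
  fixed : ∀ {x xs} → τ x ≈ x → Paired _≈_ τ xs → Paired _≈_ τ (x ∷ xs)
  pair  : ∀ {x y xs} → y ≈ τ x → Paired _≈_ τ xs → Paired _≈_ τ (x ∷ y ∷ xs)

Paired-map : ∀ {A : Set ℓ₁} {B : Set ℓ₂} {_≈_ : Rel A ℓ₃} {_≈′_ : Rel B ℓ₄} {τ τ′} →
             IsEquivalence _≈′_ → (f : A → B) →
             (∀ {x y} → x ≈ y → f x ≈′ f y) → (∀ x → f (τ x) ≈′ τ′ (f x)) →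
             ∀ {xs} → Paired _≈_ τ xs → Paired _≈′_ τ′ (map f xs)
Paired-map isEq f f-cong f-τ [] = []
Paired-map isEq f f-cong f-τ {x ∷ _} (fixed τx≈x P) =
  fixed (trans′ (sym′ (f-τ x)) (f-cong τx≈x)) (Paired-map isEq f f-cong f-τ P)
  where open IsEquivalence isEq renaming (sym to sym′; trans to trans′)
Paired-map isEq f f-cong f-τ {x ∷ _} (pair y≈τx P) =
  pair (trans′ (f-cong y≈τx) (f-τ x)) (Paired-map isEq f f-cong f-τ P)
  where open IsEquivalence isEq renaming (trans to trans′)

module _ (S : DecSetoid ℓ₁ ℓ₂) where

  open DecSetoid S using (_≈_)
    renaming (Carrier to A; _≟_ to _≈?_; refl to ≈-refl; sym to ≈-sym; trans to ≈-trans)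

  module Pairing (τ : A → A) (τ-cong : ∀ {x y} → x ≈ y → τ x ≈ τ y)
                 (τ-involutive : ∀ x → τ (τ x) ≈ x) where

    _≈ᵇ_ : A → A → Bool
    x ≈ᵇ y = does (x ≈? y)

    multiplicity : A → List A → ℕ
    multiplicity x = count (_≈ᵇ x)

    Closed : List A → Set ℓ₁
    Closed xs = ∀ x → multiplicity x xs ≡ multiplicity (τ x) xs

    ≈ᵇ-respˡ : ∀ {x y} z → x ≈ y → (x ≈ᵇ z) ≡ (y ≈ᵇ z)
    ≈ᵇ-respˡ z x≈y = does-⇔ (mk⇔ (≈-trans (≈-sym x≈y)) (≈-trans x≈y)) (_ ≈? z) (_ ≈? z)

    ≈ᵇ-respʳ : ∀ {x y} z → x ≈ y → (z ≈ᵇ x) ≡ (z ≈ᵇ y)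
    ≈ᵇ-respʳ z x≈y =
      does-⇔ (mk⇔ (λ z≈x → ≈-trans z≈x x≈y) (λ z≈y → ≈-trans z≈y (≈-sym x≈y))) (z ≈? _) (z ≈? _)

    ≈ᵇ-τ : ∀ x y → (x ≈ᵇ τ y) ≡ (τ x ≈ᵇ y)
    ≈ᵇ-τ x y = does-⇔ (mk⇔ (λ x≈τy → ≈-trans (τ-cong x≈τy) (τ-involutive y))
                           (λ τx≈y → ≈-trans (≈-sym (τ-involutive x)) (τ-cong τx≈y)))
                      (x ≈? τ y) (τ x ≈? y)

    multiplicity-∷ : ∀ p x xs → multiplicity p (x ∷ xs) ≡ iverson (x ≈ᵇ p) + multiplicity p xs
    multiplicity-∷ p = count-∷ (_≈ᵇ p)

    Closed-↭ : ∀ {xs ys} → xs ↭ ys → Closed xs → Closed ys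
    Closed-↭ xs↭ys closed x =
      ≡.trans (≡.sym (count-↭ (_≈ᵇ x) xs↭ys)) (≡.trans (closed x) (count-↭ (_≈ᵇ τ x) xs↭ys))

    Closed-++⁻ : ∀ xs {ys} → Closed xs → Closed (xs ++ ys) → Closed ys
    Closed-++⁻ xs {ys} xs-closed closed p = +-cancelˡ-≡ (multiplicity p xs) _ _ (begin
      multiplicity p xs + multiplicity p ys              ≡⟨ count-++ (_≈ᵇ p) xs ys ⟨
      multiplicity p (xs ++ ys)                          ≡⟨ closed p ⟩
      multiplicity (τ p) (xs ++ ys)                      ≡⟨ count-++ (_≈ᵇ τ p) xs ys ⟩
      multiplicity (τ p) xs + multiplicity (τ p) ys      ≡⟨ cong (_+ multiplicity (τ p) ys) (xs-closed p) ⟨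
      multiplicity p xs + multiplicity (τ p) ys          ∎)
      where open ≡-Reasoning

    closed-fixed : ∀ {x} → τ x ≈ x → Closed [ x ]
    closed-fixed {x} τx≈x p = begin
      multiplicity p [ x ]          ≡⟨ multiplicity-∷ p x [] ⟩
      iverson (x ≈ᵇ p) + 0          ≡⟨ cong (λ c → iverson c + 0) (≡.trans (≈ᵇ-τ x p) (≈ᵇ-respˡ p τx≈x)) ⟨
      iverson (x ≈ᵇ τ p) + 0        ≡⟨ multiplicity-∷ (τ p) x [] ⟨
      multiplicity (τ p) [ x ]      ∎
      where open ≡-Reasoning

    closed-pair : ∀ {x y} → y ≈ τ x → Closed (x ∷ y ∷ [])
    closed-pair {x} {y} y≈τx p = begin
      multiplicity p (x ∷ y ∷ [])                    ≡⟨ weight p ⟩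
      iverson (x ≈ᵇ p) + iverson (x ≈ᵇ τ p)          ≡⟨ +-comm (iverson (x ≈ᵇ p)) (iverson (x ≈ᵇ τ p)) ⟩
      iverson (x ≈ᵇ τ p) + iverson (x ≈ᵇ p)
        ≡⟨ cong (λ c → iverson (x ≈ᵇ τ p) + iverson c) (≈ᵇ-respʳ x (τ-involutive p)) ⟨
      iverson (x ≈ᵇ τ p) + iverson (x ≈ᵇ τ (τ p))    ≡⟨ weight (τ p) ⟨
      multiplicity (τ p) (x ∷ y ∷ [])                ∎
      where
      open ≡-Reasoning
      weight : ∀ q → multiplicity q (x ∷ y ∷ []) ≡ iverson (x ≈ᵇ q) + iverson (x ≈ᵇ τ q)
      weight q = begin
        multiplicity q (x ∷ y ∷ [])                  ≡⟨ multiplicity-∷ q x (y ∷ []) ⟩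
        iverson (x ≈ᵇ q) + multiplicity q [ y ]      ≡⟨ cong (_+_ (iverson (x ≈ᵇ q))) (multiplicity-∷ q y []) ⟩
        iverson (x ≈ᵇ q) + (iverson (y ≈ᵇ q) + 0)    ≡⟨ cong (_+_ (iverson (x ≈ᵇ q))) (+-identityʳ (iverson (y ≈ᵇ q))) ⟩
        iverson (x ≈ᵇ q) + iverson (y ≈ᵇ q)          ≡⟨ cong (λ c → iverson (x ≈ᵇ q) + iverson c) y≈ᵇq ⟩
        iverson (x ≈ᵇ q) + iverson (x ≈ᵇ τ q)        ∎
        where
        y≈ᵇq : (y ≈ᵇ q) ≡ (x ≈ᵇ τ q)
        y≈ᵇq = ≡.trans (≈ᵇ-respˡ q y≈τx) (≡.sym (≈ᵇ-τ x q))

    multiplicity-τ : ∀ {x xs} → ¬ τ x ≈ x → Closed (x ∷ xs) → multiplicity (τ x) xs ≡ suc (multiplicity x xs)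
    multiplicity-τ {x} {xs} τx≉x closed = begin
      multiplicity (τ x) xs                       ≡⟨ cong (λ c → iverson c + multiplicity (τ x) xs) x≉ᵇτx ⟨
      iverson (x ≈ᵇ τ x) + multiplicity (τ x) xs  ≡⟨ multiplicity-∷ (τ x) x xs ⟨
      multiplicity (τ x) (x ∷ xs)                 ≡⟨ closed (τ x) ⟩
      multiplicity (τ (τ x)) (x ∷ xs)             ≡⟨ count-≗ (λ z → ≈ᵇ-respʳ z (τ-involutive x)) (x ∷ xs) ⟩
      multiplicity x (x ∷ xs)                     ≡⟨ multiplicity-∷ x x xs ⟩
      iverson (x ≈ᵇ x) + multiplicity x xs        ≡⟨ cong (λ c → iverson c + multiplicity x xs) (dec-true (x ≈? x) ≈-refl) ⟩
      suc (multiplicity x xs)                     ∎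
      where
      open ≡-Reasoning
      x≉ᵇτx : (x ≈ᵇ τ x) ≡ false
      x≉ᵇτx = dec-false (x ≈? τ x) (τx≉x ∘ ≈-sym)

    partner : ∀ {x xs} → ¬ τ x ≈ x → Closed (x ∷ xs) → ∃[ y ] ∃[ ys ] xs ↭ y ∷ ys × y ≈ τ x
    partner {x} {xs} τx≉x closed
      with y , y∈xs , y≈ᵇτx ←
             find (count-pos⇒Any (_≈ᵇ τ x) {xs} (≡.subst (0 <_) (≡.sym (multiplicity-τ τx≉x closed)) (s≤s z≤n)))
      with ys , zs , ≡.refl ← ∈-∃++ y∈xs
      = y , ys ++ zs , ↭-shift y ys zs , Equivalence.to (T-does (y ≈? τ x)) y≈ᵇτx

    closed⇒paired : ∀ {xs} → Closed xs → ∃[ ys ] xs ↭ ys × Paired _≈_ τ ys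
    closed⇒paired {xs} = go (length xs) ≤-refl
      where
      go : ∀ k {xs} → length xs ≤ k → Closed xs → ∃[ ys ] xs ↭ ys × Paired _≈_ τ ys
      go _ {[]} _ _ = [] , ↭-refl , []
      go (suc k) {x ∷ xs} (s≤s |xs|≤k) closed with τ x ≈? x
      ... | yes τx≈x =
        let ys , xs↭ys , P = go k |xs|≤k (Closed-++⁻ [ x ] (closed-fixed τx≈x) closed)
        in x ∷ ys , ↭.prep x xs↭ys , fixed τx≈x P
      ... | no τx≉x with y , zs , xs↭y∷zs , y≈τx ← partner τx≉x closed =
        let |zs|≤k = ≤-trans (n≤1+n _) (≡.subst (_≤ k) (↭-length xs↭y∷zs) |xs|≤k)
            closed-zs = Closed-++⁻ (x ∷ y ∷ []) (closed-pair y≈τx) (Closed-↭ (↭.prep x xs↭y∷zs) closed)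
            ws , zs↭ws , P = go k |zs|≤k closed-zs
        in x ∷ y ∷ ws , ↭.prep x (↭-trans xs↭y∷zs (↭.prep y zs↭ws)) , pair y≈τx P

-- Sublists with a prescribed sum, and a transposition of coordinates

⟦_⟧ : Bool → ℤ
⟦ b ⟧ = + iverson b

_⊖_ : Vector ℤ n → Vector Bool n → Vector ℤ n
(r ⊖ s) v = r v - ⟦ s v ⟧

isZero : Vector ℤ n → Bool
isZero r = does (all? (λ v → 0ℤ ℤ.≟ r v))

-- ways ss r counts the sublists of ss whose indicator vectors sum to r; integer
-- targets let r ⊖ s go negative instead of truncating.
ways : List (Vector Bool n) → Vector ℤ n → ℕ
ways []       r = iverson (isZero r)
ways (s ∷ ss) r = ways ss (r ⊖ s) + ways ss r

ways-cong : ∀ (ss : List (Vector Bool n)) {r r′} → r ≗ r′ → ways ss r ≡ ways ss r′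
ways-cong [] {r} {r′} r≗r′ = cong iverson (does-⇔ (mk⇔ (λ r≡0 v → ≡.trans (r≡0 v) (r≗r′ v))
                                                    (λ r′≡0 v → ≡.trans (r′≡0 v) (≡.sym (r≗r′ v))))
                                         (all? (λ v → 0ℤ ℤ.≟ r v)) (all? (λ v → 0ℤ ℤ.≟ r′ v)))
ways-cong (s ∷ ss) r≗r′ = cong₂ _+_ (ways-cong ss (λ v → cong (_- ⟦ s v ⟧) (r≗r′ v))) (ways-cong ss r≗r′)

⊖-comm : ∀ (r : Vector ℤ n) s t → (r ⊖ s) ⊖ t ≗ (r ⊖ t) ⊖ s
⊖-comm r s t v = sub-comm (r v) ⟦ s v ⟧ ⟦ t v ⟧
  where
  sub-comm : ∀ x y z → x - y - z ≡ x - z - y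
  sub-comm = solve-∀

ways-swap : ∀ s t (ss : List (Vector Bool n)) r → ways (s ∷ t ∷ ss) r ≡ ways (t ∷ s ∷ ss) r
ways-swap s t ss r = ≡.trans
  (cong (λ w → (w + ways ss (r ⊖ s)) + (ways ss (r ⊖ t) + ways ss r)) (ways-cong ss (⊖-comm r s t)))
  (interchange (ways ss ((r ⊖ t) ⊖ s)) (ways ss (r ⊖ s)) (ways ss (r ⊖ t)) (ways ss r))

ways-∷⁺ : ∀ s {ss ts : List (Vector Bool n)} →
          (∀ r → ways ss r ≡ ways ts r) → ∀ r → ways (s ∷ ss) r ≡ ways (s ∷ ts) r
ways-∷⁺ s ss≡ts r = cong₂ _+_ (ss≡ts (r ⊖ s)) (ss≡ts r)

ways-↭ : ∀ {ss ts : List (Vector Bool n)} → ss ↭ ts → ∀ r → ways ss r ≡ ways ts r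
ways-↭ ↭.refl                                 r = ≡.refl
ways-↭ (↭.prep {xs = ss} {ys = ts} s ss↭ts)   r = ways-∷⁺ s {ss} {ts} (ways-↭ ss↭ts) r
ways-↭ (↭.swap {xs = ss} {ys = ts} s t ss↭ts) r =
  ≡.trans (ways-swap s t ss r) (ways-∷⁺ t {s ∷ ss} {s ∷ ts} (ways-∷⁺ s {ss} {ts} (ways-↭ ss↭ts)) r)
ways-↭ (↭.trans ss↭ts ts↭us)                  r = ≡.trans (ways-↭ ss↭ts r) (ways-↭ ts↭us r)

module Transposition {n : ℕ} (a b : Fin n) (a≢b : a ≢ b) where

  data Position : Fin n → Set where
    at-a  : Position a
    at-b  : Position b
    other : ∀ {v} → v ≢ a → v ≢ b → Position v

  position : ∀ v → Position v
  position v with v ≟ a | v ≟ b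
  ... | yes refl | _        = at-a
  ... | no _     | yes refl = at-b
  ... | no v≢a   | no v≢b   = other v≢a v≢b

  σ : Fin n → Fin n
  σ = transpose a b

  σ-a : σ a ≡ b
  σ-a rewrite dec-true (a ≟ a) refl = refl

  σ-b : σ b ≡ a
  σ-b rewrite dec-false (b ≟ a) (a≢b ∘ ≡.sym) | dec-true (b ≟ b) refl = refl

  σ-other : ∀ {v} → v ≢ a → v ≢ b → σ v ≡ v
  σ-other {v} v≢a v≢b rewrite dec-false (v ≟ a) v≢a | dec-false (v ≟ b) v≢b = refl

  σ-involutive : ∀ v → σ (σ v) ≡ v
  σ-involutive v with position v
  ... | at-a = ≡.trans (cong σ σ-a) σ-b
  ... | at-b = ≡.trans (cong σ σ-b) σ-a
  ... | other v≢a v≢b = ≡.trans (cong σ (σ-other v≢a v≢b)) (σ-other v≢a v≢b)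

  shift : Vector ℤ n → Vector ℤ n
  shift r v = r v - ⟦ does (v ≟ a) ⟧ +ℤ ⟦ does (v ≟ b) ⟧

  shift-a : ∀ r → shift r a ≡ r a - 1ℤ
  shift-a r rewrite dec-true (a ≟ a) refl | dec-false (a ≟ b) a≢b = lemma (r a)
    where
    lemma : ∀ x → x - 1ℤ +ℤ 0ℤ ≡ x - 1ℤ
    lemma = solve-∀

  shift-b : ∀ r → shift r b ≡ r b +ℤ 1ℤ
  shift-b r rewrite dec-false (b ≟ a) (a≢b ∘ ≡.sym) | dec-true (b ≟ b) refl = lemma (r b)
    where
    lemma : ∀ x → x - 0ℤ +ℤ 1ℤ ≡ x +ℤ 1ℤ
    lemma = solve-∀

  shift-other : ∀ r {v} → v ≢ a → v ≢ b → shift r v ≡ r v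
  shift-other r {v} v≢a v≢b rewrite dec-false (v ≟ a) v≢a | dec-false (v ≟ b) v≢b = lemma (r v)
    where
    lemma : ∀ x → x - 0ℤ +ℤ 0ℤ ≡ x
    lemma = solve-∀

  shift-⊖ : ∀ r s → shift (r ⊖ s) ≗ shift r ⊖ s
  shift-⊖ r s v = lemma (r v) ⟦ s v ⟧ ⟦ does (v ≟ a) ⟧ ⟦ does (v ≟ b) ⟧
    where
    lemma : ∀ x y p q → x - y - p +ℤ q ≡ x - p +ℤ q - y
    lemma = solve-∀

  Gap : Vector ℤ n → ℕ → Set
  Gap r k = r a ≡ r b +ℤ + suc k

  Invariant Monotone : List (Vector Bool n) → Set
  Invariant ss = ∀ r → ways ss (r ∘ σ) ≡ ways ss r
  Monotone  ss = ∀ r k → Gap r k → ways ss r ≤ ways ss (shift r)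

  invariant-[] : Invariant []
  invariant-[] r = cong iverson (does-⇔
    (mk⇔ (λ rσ≡0 v → ≡.trans (rσ≡0 (σ v)) (cong r (σ-involutive v))) (λ r≡0 v → r≡0 (σ v)))
    (all? (λ v → 0ℤ ℤ.≟ r (σ v))) (all? (λ v → 0ℤ ℤ.≟ r v)))

  gap⇒nonzero : ∀ {k} r → Gap r k → ¬ (∀ v → 0ℤ ≡ r v)
  gap⇒nonzero {k} r gap r≡0 with () ← ≡.trans (r≡0 a) (≡.trans gap (cong (_+ℤ + suc k) (≡.sym (r≡0 b))))

  monotone-[] : Monotone []
  monotone-[] r k gap rewrite dec-false (all? (λ v → 0ℤ ℤ.≟ r v)) (gap⇒nonzero r gap) = z≤n

  ∘σ-fixed : ∀ {s : Vector Bool n} → s a ≡ s b → s ∘ σ ≗ s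
  ∘σ-fixed {s} sa≡sb v with position v
  ... | at-a          = ≡.trans (cong s σ-a) (≡.sym sa≡sb)
  ... | at-b          = ≡.trans (cong s σ-b) sa≡sb
  ... | other v≢a v≢b = cong s (σ-other v≢a v≢b)

  gap-⊖ : ∀ {k} r s → s a ≡ s b → Gap r k → Gap (r ⊖ s) k
  gap-⊖ {k} r s sa≡sb gap = ≡.trans (cong₂ (λ x c → x - ⟦ c ⟧) gap sa≡sb) (lemma (r b) (+ suc k) ⟦ s b ⟧)
    where
    lemma : ∀ x d c → x +ℤ d - c ≡ x - c +ℤ d
    lemma = solve-∀

  invariant-fixed : ∀ {s ss} → s ∘ σ ≗ s → Invariant ss → Invariant (s ∷ ss)
  invariant-fixed {s} {ss} fix inv r = cong₂ _+_
    (≡.trans (ways-cong ss (λ v → cong (λ c → r (σ v) - ⟦ c ⟧) (≡.sym (fix v)))) (inv (r ⊖ s)))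
    (inv r)

  monotone-fixed : ∀ {s ss} → s ∘ σ ≗ s → Monotone ss → Monotone (s ∷ ss)
  monotone-fixed {s} {ss} fix mono r k gap = +-mono-≤
    (≤-trans (mono (r ⊖ s) k (gap-⊖ r s sa≡sb gap)) (≤-reflexive (ways-cong ss (shift-⊖ r s))))
    (mono r k gap)
    where
    sa≡sb : s a ≡ s b
    sa≡sb = ≡.trans (≡.sym (fix a)) (cong s σ-a)

  module _ {s s′ : Vector Bool n} (s′≗sσ : s′ ≗ s ∘ σ) where

    s′σ≗s : s′ ∘ σ ≗ s
    s′σ≗s v = ≡.trans (s′≗sσ (σ v)) (cong s (σ-involutive v))

    invariant-pair : ∀ {ss} → Invariant ss → Invariant (s ∷ s′ ∷ ss)
    invariant-pair {ss} inv r = begin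
      (W ((rσ ⊖ s) ⊖ s′) + W (rσ ⊖ s)) + (W (rσ ⊖ s′) + W rσ)
        ≡⟨ cong₂ _+_ (cong₂ _+_ both left) (cong₂ _+_ right (inv r)) ⟩
      (W ((r ⊖ s) ⊖ s′) + W (r ⊖ s′)) + (W (r ⊖ s) + W r)
        ≡⟨ interchange (W ((r ⊖ s) ⊖ s′)) (W (r ⊖ s′)) (W (r ⊖ s)) (W r) ⟩
      (W ((r ⊖ s) ⊖ s′) + W (r ⊖ s)) + (W (r ⊖ s′) + W r)
        ∎
      where
      open ≡-Reasoning
      W : Vector ℤ n → ℕ
      W = ways ss
      rσ : Vector ℤ n
      rσ = r ∘ σ
      left : W (rσ ⊖ s) ≡ W (r ⊖ s′)
      left = ≡.trans (ways-cong ss (λ v → cong (λ c → r (σ v) - ⟦ c ⟧) (≡.sym (s′σ≗s v)))) (inv (r ⊖ s′))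
      right : W (rσ ⊖ s′) ≡ W (r ⊖ s)
      right = ≡.trans (ways-cong ss (λ v → cong (λ c → r (σ v) - ⟦ c ⟧) (s′≗sσ v))) (inv (r ⊖ s))
      both : W ((rσ ⊖ s) ⊖ s′) ≡ W ((r ⊖ s) ⊖ s′)
      both = begin
        W ((rσ ⊖ s) ⊖ s′)        ≡⟨ ways-cong ss (λ v → cong₂ (λ c c′ → r (σ v) - ⟦ c ⟧ - ⟦ c′ ⟧)
                                                            (≡.sym (s′σ≗s v)) (s′≗sσ v)) ⟩
        W (((r ⊖ s′) ⊖ s) ∘ σ)   ≡⟨ inv ((r ⊖ s′) ⊖ s) ⟩
        W ((r ⊖ s′) ⊖ s)         ≡⟨ ways-cong ss (⊖-comm r s′ s) ⟩
        W ((r ⊖ s) ⊖ s′)         ∎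

    module _ (sa : s a ≡ true) (sb : s b ≡ false) where

      s′a : s′ a ≡ false
      s′a = ≡.trans (s′≗sσ a) (≡.trans (cong s σ-a) sb)

      s′b : s′ b ≡ true
      s′b = ≡.trans (s′≗sσ b) (≡.trans (cong s σ-b) sa)

      shift-⊖-exchange : ∀ r → shift r ⊖ s′ ≗ r ⊖ s
      shift-⊖-exchange r v with position v
      ... | at-a = begin
        shift r a - ⟦ s′ a ⟧   ≡⟨ cong₂ (λ x c → x - ⟦ c ⟧) (shift-a r) s′a ⟩
        r a - 1ℤ - 0ℤ          ≡⟨ lemma (r a) ⟩
        r a - 1ℤ               ≡⟨ cong (λ c → r a - ⟦ c ⟧) sa ⟨
        r a - ⟦ s a ⟧          ∎
        where
        open ≡-Reasoning
        lemma : ∀ x → x - 1ℤ - 0ℤ ≡ x - 1ℤ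
        lemma = solve-∀
      ... | at-b = begin
        shift r b - ⟦ s′ b ⟧   ≡⟨ cong₂ (λ x c → x - ⟦ c ⟧) (shift-b r) s′b ⟩
        r b +ℤ 1ℤ - 1ℤ          ≡⟨ lemma (r b) ⟩
        r b - 0ℤ               ≡⟨ cong (λ c → r b - ⟦ c ⟧) sb ⟨
        r b - ⟦ s b ⟧          ∎
        where
        open ≡-Reasoning
        lemma : ∀ x → x +ℤ 1ℤ - 1ℤ ≡ x - 0ℤ
        lemma = solve-∀
      ... | other v≢a v≢b = cong₂ (λ x c → x - ⟦ c ⟧) (shift-other r v≢a v≢b)
                                  (≡.trans (s′≗sσ v) (cong s (σ-other v≢a v≢b)))

      -- A gap of one makes the two sides σ-images of each other; a larger gap passes
      -- through r ⊖ s by monotonicity.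
      exchange : ∀ {ss} → Invariant ss → Monotone ss →
                 ∀ r k → Gap r k → ways ss (r ⊖ s′) ≤ ways ss (shift r ⊖ s)
      exchange {ss} inv mono r zero gap = ≤-reflexive (≡.trans (ways-cong ss swapped) (inv (shift r ⊖ s)))
        where
        open ≡-Reasoning
        swapped : r ⊖ s′ ≗ (shift r ⊖ s) ∘ σ
        swapped v with position v
        ... | at-a = begin
          r a - ⟦ s′ a ⟧            ≡⟨ cong₂ (λ x c → x - ⟦ c ⟧) gap s′a ⟩
          r b +ℤ 1ℤ - 0ℤ             ≡⟨ cong₂ (λ x c → x - ⟦ c ⟧) (shift-b r) sb ⟨
          (shift r ⊖ s) b           ≡⟨ cong (shift r ⊖ s) σ-a ⟨
          (shift r ⊖ s) (σ a)       ∎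
        ... | at-b = begin
          r b - ⟦ s′ b ⟧            ≡⟨ cong (λ c → r b - ⟦ c ⟧) s′b ⟩
          r b - 1ℤ                  ≡⟨ lemma (r b) ⟩
          r b +ℤ 1ℤ - 1ℤ - 1ℤ        ≡⟨ cong₂ (λ x c → x - 1ℤ - ⟦ c ⟧) gap sa ⟨
          r a - 1ℤ - ⟦ s a ⟧        ≡⟨ cong (λ x → x - ⟦ s a ⟧) (shift-a r) ⟨
          (shift r ⊖ s) a           ≡⟨ cong (shift r ⊖ s) σ-b ⟨
          (shift r ⊖ s) (σ b)       ∎
          where
          lemma : ∀ x → x - 1ℤ ≡ x +ℤ 1ℤ - 1ℤ - 1ℤ
          lemma = solve-∀
        ... | other v≢a v≢b = begin
          r v - ⟦ s′ v ⟧            ≡⟨ cong (λ c → r v - ⟦ c ⟧) (≡.trans (s′≗sσ v) (cong s (σ-other v≢a v≢b))) ⟩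
          r v - ⟦ s v ⟧             ≡⟨ cong (λ x → x - ⟦ s v ⟧) (shift-other r v≢a v≢b) ⟨
          (shift r ⊖ s) v           ≡⟨ cong (shift r ⊖ s) (σ-other v≢a v≢b) ⟨
          (shift r ⊖ s) (σ v)       ∎
      exchange {ss} inv mono r (suc k) gap = begin
        ways ss (r ⊖ s′)           ≤⟨ mono (r ⊖ s′) (suc (suc k)) gap′ ⟩
        ways ss (shift (r ⊖ s′))   ≡⟨ ways-cong ss (λ v → ≡.trans (shift-⊖ r s′ v) (shift-⊖-exchange r v)) ⟩
        ways ss (r ⊖ s)            ≤⟨ mono (r ⊖ s) k gap″ ⟩
        ways ss (shift (r ⊖ s))    ≡⟨ ways-cong ss (shift-⊖ r s) ⟩
        ways ss (shift r ⊖ s)      ∎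
        where
        open ≤-Reasoning
        gap′ : Gap (r ⊖ s′) (suc (suc k))
        gap′ = ≡.trans (cong₂ (λ x c → x - ⟦ c ⟧) gap s′a)
                       (≡.trans (lemma (r b) (+ k)) (cong (λ c → r b - ⟦ c ⟧ +ℤ + suc (suc (suc k))) (≡.sym s′b)))
          where
          lemma : ∀ x m → x +ℤ (1ℤ +ℤ (1ℤ +ℤ m)) - 0ℤ ≡ x - 1ℤ +ℤ (1ℤ +ℤ (1ℤ +ℤ (1ℤ +ℤ m)))
          lemma = solve-∀
        gap″ : Gap (r ⊖ s) k
        gap″ = ≡.trans (cong₂ (λ x c → x - ⟦ c ⟧) gap sa)
                       (≡.trans (lemma (r b) (+ k)) (cong (λ c → r b - ⟦ c ⟧ +ℤ + suc k) (≡.sym sb)))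
          where
          lemma : ∀ x m → x +ℤ (1ℤ +ℤ (1ℤ +ℤ m)) - 1ℤ ≡ x - 0ℤ +ℤ (1ℤ +ℤ m)
          lemma = solve-∀

      monotone-pair-oriented : ∀ {ss} → Invariant ss → Monotone ss → Monotone (s ∷ s′ ∷ ss)
      monotone-pair-oriented {ss} inv mono r k gap = begin
        (W ((r ⊖ s) ⊖ s′) + W (r ⊖ s)) + (W (r ⊖ s′) + W r)
          ≤⟨ +-mono-≤ (+-mono-≤ both (≤-reflexive left)) (+-mono-≤ (exchange {ss} inv mono r k gap) (mono r k gap)) ⟩
        (W ((r′ ⊖ s) ⊖ s′) + W (r′ ⊖ s′)) + (W (r′ ⊖ s) + W r′)
          ≡⟨ interchange (W ((r′ ⊖ s) ⊖ s′)) (W (r′ ⊖ s′)) (W (r′ ⊖ s)) (W r′) ⟩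
        (W ((r′ ⊖ s) ⊖ s′) + W (r′ ⊖ s)) + (W (r′ ⊖ s′) + W r′)
          ∎
        where
        open ≤-Reasoning
        W : Vector ℤ n → ℕ
        W = ways ss
        r′ : Vector ℤ n
        r′ = shift r
        left : W (r ⊖ s) ≡ W (r′ ⊖ s′)
        left = ≡.sym (ways-cong ss (shift-⊖-exchange r))
        gap‴ : Gap ((r ⊖ s) ⊖ s′) k
        gap‴ = ≡.trans (cong₂ (λ x c → x - ⟦ c ⟧) lowered s′a)
                       (≡.trans (lemma (r b) (+ suc k))
                                (cong₂ (λ c c′ → r b - ⟦ c ⟧ - ⟦ c′ ⟧ +ℤ + suc k) (≡.sym sb) (≡.sym s′b)))
          where
          lowered : r a - ⟦ s a ⟧ ≡ r b +ℤ + suc k - 1ℤ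
          lowered = cong₂ (λ x c → x - ⟦ c ⟧) gap sa
          lemma : ∀ x d → x +ℤ d - 1ℤ - 0ℤ ≡ x - 0ℤ - 1ℤ +ℤ d
          lemma = solve-∀
        both : W ((r ⊖ s) ⊖ s′) ≤ W ((r′ ⊖ s) ⊖ s′)
        both = ≤-trans (mono ((r ⊖ s) ⊖ s′) k gap‴)
                       (≤-reflexive (ways-cong ss (λ v → ≡.trans (shift-⊖ (r ⊖ s) s′ v)
                                                                 (cong (_- ⟦ s′ v ⟧) (shift-⊖ r s v)))))

  monotone-pair-fixed : ∀ {s s′ ss} → s′ ≗ s ∘ σ → s a ≡ s b → Monotone ss → Monotone (s ∷ s′ ∷ ss)
  monotone-pair-fixed {s} {s′} {ss} s′≗sσ sa≡sb mono =
    monotone-fixed {s} {s′ ∷ ss} sσ≗s (monotone-fixed {s′} {ss} s′σ≗s′ mono)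
    where
    sσ≗s : s ∘ σ ≗ s
    sσ≗s = ∘σ-fixed sa≡sb
    s′σ≗s′ : s′ ∘ σ ≗ s′
    s′σ≗s′ v = ≡.trans (s′σ≗s {s} {s′} s′≗sσ v) (≡.trans (≡.sym (sσ≗s v)) (≡.sym (s′≗sσ v)))

  monotone-pair : ∀ {s s′ ss} → s′ ≗ s ∘ σ → Invariant ss → Monotone ss → Monotone (s ∷ s′ ∷ ss)
  monotone-pair {s} {s′} {ss} s′≗sσ inv mono with s a in sa | s b in sb
  ... | true  | false = monotone-pair-oriented {s} {s′} s′≗sσ sa sb {ss} inv mono
  ... | false | true  = λ r k gap → subst₂ _≤_ (ways-swap s′ s ss r) (ways-swap s′ s ss (shift r))
      (monotone-pair-oriented {s′} {s} (≡.sym ∘ s′σ≗s {s} {s′} s′≗sσ) s′a≡true s′b≡false {ss} inv mono r k gap)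
    where
    s′a≡true : s′ a ≡ true
    s′a≡true = ≡.trans (s′≗sσ a) (≡.trans (cong s σ-a) sb)
    s′b≡false : s′ b ≡ false
    s′b≡false = ≡.trans (s′≗sσ b) (≡.trans (cong s σ-b) sa)
  ... | true  | true  = monotone-pair-fixed {s} {s′} {ss} s′≗sσ (≡.trans sa (≡.sym sb)) mono
  ... | false | false = monotone-pair-fixed {s} {s′} {ss} s′≗sσ (≡.trans sa (≡.sym sb)) mono

  Symmetric : List (Vector Bool n) → Set
  Symmetric = Paired _≗_ (_∘ σ)

  symmetric⇒invariant : ∀ {ss} → Symmetric ss → Invariant ss
  symmetric⇒invariant []              = invariant-[]
  symmetric⇒invariant {s ∷ ss}      (fixed sσ≗s P) = invariant-fixed {s} {ss} sσ≗s (symmetric⇒invariant P)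
  symmetric⇒invariant {s ∷ s′ ∷ ss} (pair s′≗sσ P) = invariant-pair {s} {s′} s′≗sσ {ss} (symmetric⇒invariant P)

  symmetric⇒monotone : ∀ {ss} → Symmetric ss → Monotone ss
  symmetric⇒monotone []              = monotone-[]
  symmetric⇒monotone {s ∷ ss}      (fixed sσ≗s P) = monotone-fixed {s} {ss} sσ≗s (symmetric⇒monotone P)
  symmetric⇒monotone {s ∷ s′ ∷ ss} (pair s′≗sσ P) =
    monotone-pair {s} {s′} {ss} s′≗sσ (symmetric⇒invariant P) (symmetric⇒monotone P)

-- Graphs with given degrees

incident : Fin n × Fin n → Fin n → Bool
incident e v = (toℕ (proj₁ e) ≡ᵇ toℕ v) ∨ (toℕ (proj₂ e) ≡ᵇ toℕ v)

toℤ : Vector ℕ n → Vector ℤ n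
toℤ d v = + d v

fits : Vector ℤ n → List (Fin n × Fin n) → Bool
fits r S = does (all? (λ v → + degree S v ℤ.≟ r v))

hasDegrees≡fits : ∀ (d : Vector ℕ n) S → hasDegrees d S ≡ fits (toℤ d) S
hasDegrees≡fits d S = allᵇ-allFin (λ v → + degree S v ℤ.≟ + d v)

fits-∷ : ∀ (r : Vector ℤ n) e S → fits r (e ∷ S) ≡ fits (r ⊖ incident e) S
fits-∷ r e S = does-⇔ (mk⇔ (λ h v → to v (h v)) (λ h v → from v (h v)))
                      (all? (λ v → + degree (e ∷ S) v ℤ.≟ r v)) (all? (λ v → + degree S v ℤ.≟ (r ⊖ incident e) v))
  where
  degree-∷ : ∀ v → + degree (e ∷ S) v ≡ ⟦ incident e v ⟧ +ℤ + degree S v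
  degree-∷ v = ≡.trans (cong +_ (count-∷ (λ e → incident e v) e S)) (pos-+ (iverson (incident e v)) (degree S v))
  to : ∀ v → + degree (e ∷ S) v ≡ r v → + degree S v ≡ r v - ⟦ incident e v ⟧
  to v eq = ≡.trans (lemma ⟦ incident e v ⟧ (+ degree S v)) (cong (_- ⟦ incident e v ⟧) (≡.trans (≡.sym (degree-∷ v)) eq))
    where
    lemma : ∀ x y → y ≡ x +ℤ y - x
    lemma = solve-∀
  from : ∀ v → + degree S v ≡ r v - ⟦ incident e v ⟧ → + degree (e ∷ S) v ≡ r v
  from v eq = ≡.trans (degree-∷ v) (≡.trans (cong (⟦ incident e v ⟧ +ℤ_) eq) (lemma ⟦ incident e v ⟧ (r v)))
    where
    lemma : ∀ x z → x +ℤ (z - x) ≡ z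
    lemma = solve-∀

count-fits : ∀ (L : List (Fin n × Fin n)) r → count (fits r) (sublists L) ≡ ways (map incident L) r
count-fits []      r = ≡.trans (count-∷ (fits r) [] []) (+-identityʳ _)
count-fits {n = n} (e ∷ L) r = begin
  count (fits r) (map (e ∷_) Ss ++ Ss)                  ≡⟨ count-++ (fits r) (map (e ∷_) Ss) Ss ⟩
  count (fits r) (map (e ∷_) Ss) + count (fits r) Ss    ≡⟨ cong (_+ count (fits r) Ss) (count-map (fits r) (e ∷_) Ss) ⟩
  count (fits r ∘ (e ∷_)) Ss + count (fits r) Ss        ≡⟨ cong (_+ count (fits r) Ss) (count-≗ (fits-∷ r e) Ss) ⟩
  count (fits (r ⊖ incident e)) Ss + count (fits r) Ss  ≡⟨ cong₂ _+_ (count-fits L (r ⊖ incident e)) (count-fits L r) ⟩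
  ways (map incident L) (r ⊖ incident e) + ways (map incident L) r  ∎
  where
  open ≡-Reasoning
  Ss : List (List (Fin n × Fin n))
  Ss = sublists L

g≡ways : ∀ (d : Vector ℕ n) → g d ≡ ways (map incident (possibleEdges n)) (toℤ d)
g≡ways {n} d = ≡.trans (count-≗ (hasDegrees≡fits d) (allGraphs n)) (count-fits (possibleEdges n) (toℤ d))

_≟ₖ_ : DecidableEquality (ℕ × ℕ)
_≟ₖ_ = ≡-dec _≟ℕ_ _≟ℕ_

-- Edges are compared as unordered pairs, through their sorted endpoints.
key : Fin n × Fin n → ℕ × ℕ
key (i , j) = toℕ i ⊓ toℕ j , toℕ i ⊔ toℕ j

⊓⊔-sorted : ∀ {u w} → u ≤ w → (u ⊓ w , u ⊔ w) ≡ (u , w)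
⊓⊔-sorted u≤w = cong₂ _,_ (m≤n⇒m⊓n≡m u≤w) (m≤n⇒m⊔n≡n u≤w)

⊓⊔-sorted-or-swapped : ∀ u w → (u ⊓ w , u ⊔ w) ≡ (u , w) ⊎ (u ⊓ w , u ⊔ w) ≡ (w , u)
⊓⊔-sorted-or-swapped u w with ≤-total u w
... | inj₁ u≤w = inj₁ (⊓⊔-sorted u≤w)
... | inj₂ w≤u = inj₂ (cong₂ _,_ (m≥n⇒m⊓n≡n w≤u) (m≥n⇒m⊔n≡m w≤u))

module _ (x y : ℕ) where

  possibleEdge-key : ∀ u w → ((u <ᵇ w) ∧ does ((u ⊓ w , u ⊔ w) ≟ₖ (x , y))) ≡ (((x <ᵇ y) ∧ (u ≡ᵇ x)) ∧ (w ≡ᵇ y))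
  possibleEdge-key u w = T-⇔⇒≡ (mk⇔ to from)
    where
    to : T ((u <ᵇ w) ∧ does ((u ⊓ w , u ⊔ w) ≟ₖ (x , y))) → T (((x <ᵇ y) ∧ (u ≡ᵇ x)) ∧ (w ≡ᵇ y))
    to t with u<w , k ← Equivalence.to T-∧ t
         with ≡.refl ← ≡.trans (≡.sym (⊓⊔-sorted (<⇒≤ (<ᵇ⇒< u w u<w)))) (Equivalence.to (T-does (_ ≟ₖ _)) k)
       = Equivalence.from T-∧ (Equivalence.from T-∧ (u<w , ≡⇒≡ᵇ u u ≡.refl) , ≡⇒≡ᵇ w w ≡.refl)
    from : T (((x <ᵇ y) ∧ (u ≡ᵇ x)) ∧ (w ≡ᵇ y)) → T ((u <ᵇ w) ∧ does ((u ⊓ w , u ⊔ w) ≟ₖ (x , y)))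
    from t with t′ , w≡y ← Equivalence.to T-∧ t
           with x<y , u≡x ← Equivalence.to T-∧ t′
           with ≡.refl ← ≡ᵇ⇒≡ u x u≡x | ≡.refl ← ≡ᵇ⇒≡ w y w≡y
       = Equivalence.from T-∧ (x<y , Equivalence.from (T-does (_ ≟ₖ _)) (⊓⊔-sorted (<⇒≤ (<ᵇ⇒< x y x<y))))

  possibleEdges-count : y < n → count (λ e → does (key e ≟ₖ (x , y))) (possibleEdges n) ≡ iverson (x <ᵇ y)
  possibleEdges-count {n} y<n = begin
    count q (concatMap row (allFin n))     ≡⟨ count-concatMap q row (allFin n) ⟩
    sum (map (count q ∘ row) (allFin n))   ≡⟨ cong sum (map-cong row-count (allFin n)) ⟩
    sum (map (iverson ∘ c) (allFin n))     ≡⟨ count≡sum c (allFin n) ⟨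
    count c (allFin n)                     ≡⟨ column-count ⟩
    iverson (x <ᵇ y)                       ∎
    where
    open ≡-Reasoning
    q : Fin n × Fin n → Bool
    q e = does (key e ≟ₖ (x , y))
    after : Fin n → Fin n → Bool
    after i j = toℕ i <ᵇ toℕ j
    row : Fin n → List (Fin n × Fin n)
    row i = map (i ,_) (filterᵇ (after i) (allFin n))
    c : Fin n → Bool
    c i = (x <ᵇ y) ∧ (toℕ i ≡ᵇ x)
    row-count : ∀ i → count q (row i) ≡ iverson (c i)
    row-count i = begin
      count q (row i)                                  ≡⟨ count-map q (i ,_) (filterᵇ (after i) (allFin n)) ⟩
      count (q ∘ (i ,_)) (filterᵇ (after i) (allFin n)) ≡⟨ count-filterᵇ (after i) (q ∘ (i ,_)) (allFin n) ⟩
      count (λ j → after i j ∧ q (i , j)) (allFin n)    ≡⟨ count-≗ (λ j → possibleEdge-key (toℕ i) (toℕ j)) (allFin n) ⟩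
      count (λ j → c i ∧ (toℕ j ≡ᵇ y)) (allFin n)       ≡⟨ count-const-∧ (c i) (λ j → toℕ j ≡ᵇ y) (allFin n) ⟩
      iverson (c i) * count (λ j → toℕ j ≡ᵇ y) (allFin n) ≡⟨ cong (iverson (c i) *_) (count-toℕ-allFin y y<n) ⟩
      iverson (c i) * 1                                ≡⟨ *-identityʳ (iverson (c i)) ⟩
      iverson (c i)                                    ∎
    column-count : count c (allFin n) ≡ iverson (x <ᵇ y)
    column-count with x <ᵇ y in x<ᵇy
    ... | true  = count-toℕ-allFin x (<-trans (<ᵇ⇒< x y (Equivalence.from T-≡ x<ᵇy)) y<n)
    ... | false = count-false (allFin n)

⊓<ᵇ⊔ : ∀ m n → (m ⊓ n <ᵇ m ⊔ n) ≡ not (m ≡ᵇ n)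
⊓<ᵇ⊔ zero    zero    = ≡.refl
⊓<ᵇ⊔ zero    (suc n) = ≡.refl
⊓<ᵇ⊔ (suc m) zero    = ≡.refl
⊓<ᵇ⊔ (suc m) (suc n) = ⊓<ᵇ⊔ m n

possibleEdges-multiplicity : ∀ (p : Fin n × Fin n) →
  count (λ e → does (key e ≟ₖ key p)) (possibleEdges n) ≡ iverson (not (toℕ (proj₁ p) ≡ᵇ toℕ (proj₂ p)))
possibleEdges-multiplicity (i , j) =
  ≡.trans (possibleEdges-count (toℕ i ⊓ toℕ j) (toℕ i ⊔ toℕ j) (⊔-lub (toℕ<n i) (toℕ<n j)))
          (cong iverson (⊓<ᵇ⊔ (toℕ i) (toℕ j)))

key-swap : ∀ (e : Fin n × Fin n) → key (swap e) ≡ key e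
key-swap (i , j) = cong₂ _,_ (⊓-comm (toℕ j) (toℕ i)) (⊔-comm (toℕ j) (toℕ i))

toℕ-pair-injective : ∀ {u w u′ w′ : Fin n} → (toℕ u , toℕ w) ≡ (toℕ u′ , toℕ w′) → (u , w) ≡ (u′ , w′)
toℕ-pair-injective eq = let u≡u′ , w≡w′ = ,-injective eq in cong₂ _,_ (toℕ-injective u≡u′) (toℕ-injective w≡w′)

key-injective : ∀ {e e′ : Fin n × Fin n} → key e ≡ key e′ → e ≡ e′ ⊎ e ≡ swap e′
key-injective {e = i , j} {i′ , j′} k≡k′
  with ⊓⊔-sorted-or-swapped (toℕ i) (toℕ j) | ⊓⊔-sorted-or-swapped (toℕ i′) (toℕ j′)
... | inj₁ k≡ | inj₁ k′≡ = inj₁ (toℕ-pair-injective (≡.trans (≡.sym k≡) (≡.trans k≡k′ k′≡)))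
... | inj₁ k≡ | inj₂ k′≡ = inj₂ (toℕ-pair-injective (≡.trans (≡.sym k≡) (≡.trans k≡k′ k′≡)))
... | inj₂ k≡ | inj₁ k′≡ = inj₂ (cong swap (toℕ-pair-injective (≡.trans (≡.sym k≡) (≡.trans k≡k′ k′≡))))
... | inj₂ k≡ | inj₂ k′≡ = inj₁ (cong swap (toℕ-pair-injective (≡.trans (≡.sym k≡) (≡.trans k≡k′ k′≡))))

incident-cong : ∀ {e e′ : Fin n × Fin n} → key e ≡ key e′ → incident e ≗ incident e′
incident-cong {e′ = i , j} k≡k′ v with key-injective k≡k′
... | inj₁ ≡.refl = ≡.refl
... | inj₂ ≡.refl = ∨-comm (toℕ j ≡ᵇ toℕ v) (toℕ i ≡ᵇ toℕ v)

EdgeSetoid : ℕ → DecSetoid _ _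
EdgeSetoid n = On.decSetoid (decSetoid _≟ₖ_) (key {n})

module EdgeTransposition {n : ℕ} (a b : Fin n) (a≢b : a ≢ b) where

  open Transposition a b a≢b

  σ̂ : Fin n × Fin n → Fin n × Fin n
  σ̂ = Product.map σ σ

  σ̂-cong : ∀ {e e′} → key e ≡ key e′ → key (σ̂ e) ≡ key (σ̂ e′)
  σ̂-cong {e′ = e′} k≡k′ with key-injective k≡k′
  ... | inj₁ ≡.refl = ≡.refl
  ... | inj₂ ≡.refl = key-swap (σ̂ e′)

  σ̂-involutive : ∀ e → key (σ̂ (σ̂ e)) ≡ key e
  σ̂-involutive (i , j) = cong key (cong₂ _,_ (σ-involutive i) (σ-involutive j))

  ≡ᵇ-σ : ∀ u v → (toℕ (σ u) ≡ᵇ toℕ v) ≡ (toℕ u ≡ᵇ toℕ (σ v))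
  ≡ᵇ-σ u v = T-⇔⇒≡ (mk⇔
    (λ t → ≡⇒≡ᵇ (toℕ u) (toℕ (σ v))
             (cong toℕ (≡.trans (≡.sym (σ-involutive u)) (cong σ (toℕ-injective (≡ᵇ⇒≡ (toℕ (σ u)) (toℕ v) t))))))
    (λ t → ≡⇒≡ᵇ (toℕ (σ u)) (toℕ v)
             (cong toℕ (≡.trans (cong σ (toℕ-injective (≡ᵇ⇒≡ (toℕ u) (toℕ (σ v)) t))) (σ-involutive v)))))

  incident-σ̂ : ∀ e → incident (σ̂ e) ≗ incident e ∘ σ
  incident-σ̂ (i , j) v = cong₂ _∨_ (≡ᵇ-σ i v) (≡ᵇ-σ j v)

  open Pairing (EdgeSetoid n) σ̂ σ̂-cong σ̂-involutive

  possibleEdges-closed : Closed (possibleEdges n)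
  possibleEdges-closed (i , j) = begin
    multiplicity (i , j) (possibleEdges n)          ≡⟨ possibleEdges-multiplicity (i , j) ⟩
    iverson (not (toℕ i ≡ᵇ toℕ j))                  ≡⟨ cong (iverson ∘ not) σ-preserves-≡ᵇ ⟨
    iverson (not (toℕ (σ i) ≡ᵇ toℕ (σ j)))          ≡⟨ possibleEdges-multiplicity (σ̂ (i , j)) ⟨
    multiplicity (σ̂ (i , j)) (possibleEdges n)      ∎
    where
    open ≡-Reasoning
    σ-preserves-≡ᵇ : (toℕ (σ i) ≡ᵇ toℕ (σ j)) ≡ (toℕ i ≡ᵇ toℕ j)
    σ-preserves-≡ᵇ = ≡.trans (≡ᵇ-σ i (σ j)) (cong (λ w → toℕ i ≡ᵇ toℕ w) (σ-involutive j))

  incidences-symmetric : ∃[ ss ] map incident (possibleEdges n) ↭ ss × Symmetric ss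
  incidences-symmetric =
    let es , PE↭es , paired = closed⇒paired possibleEdges-closed
    in map incident es , ↭-map⁺ incident PE↭es ,
       Paired-map (Pointwise.isEquivalence ≡.isEquivalence n) incident incident-cong incident-σ̂ paired

  incidences-monotone : Monotone (map incident (possibleEdges n))
  incidences-monotone r k gap =
    let ss , PE↭ss , symmetric = incidences-symmetric
    in subst₂ _≤_ (≡.sym (ways-↭ PE↭ss r)) (≡.sym (ways-↭ PE↭ss (shift r)))
                  (symmetric⇒monotone symmetric r k gap)

-- Moving one unit of degree, and balancing

move : Vector ℕ n → Fin n → Fin n → Vector ℕ n
move d a b = updateAt (updateAt d a pred) b suc

module _ (d : Vector ℕ n) {a b : Fin n} (a≢b : a ≢ b) where

  move-a : move d a b a ≡ pred (d a)
  move-a = ≡.trans (updateAt-minimal a b (updateAt d a pred) a≢b) (updateAt-updates a d)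

  move-b : move d a b b ≡ suc (d b)
  move-b = ≡.trans (updateAt-updates b (updateAt d a pred)) (cong suc (updateAt-minimal b a d (a≢b ∘ ≡.sym)))

  move-other : ∀ {v} → v ≢ a → v ≢ b → move d a b v ≡ d v
  move-other {v} v≢a v≢b = ≡.trans (updateAt-minimal v b (updateAt d a pred) v≢b) (updateAt-minimal v a d v≢a)

  open Transposition a b a≢b
  open EdgeTransposition a b a≢b

  toℤ-move : 0 < d a → toℤ (move d a b) ≗ shift (toℤ d)
  toℤ-move 0<da v with position v
  ... | at-a          = ≡.trans (cong +_ move-a) (≡.trans (pos-pred 0<da) (≡.sym (shift-a (toℤ d))))
    where
    pos-pred : ∀ {m} → 0 < m → + pred m ≡ + m - 1ℤ
    pos-pred {suc m} _ = ≡.refl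
  ... | at-b          = ≡.trans (cong +_ (≡.trans move-b (+-comm 1 (d b)))) (≡.sym (shift-b (toℤ d)))
  ... | other v≢a v≢b = ≡.trans (cong +_ (move-other v≢a v≢b)) (≡.sym (shift-other (toℤ d) v≢a v≢b))

  g-move : d b < d a → g d ≤ g (move d a b)
  g-move db<da = begin
    g d                          ≡⟨ g≡ways d ⟩
    ways E (toℤ d)               ≤⟨ incidences-monotone (toℤ d) k gap ⟩
    ways E (shift (toℤ d))       ≡⟨ ways-cong E (toℤ-move (≤-trans (s≤s z≤n) db<da)) ⟨
    ways E (toℤ (move d a b))    ≡⟨ g≡ways (move d a b) ⟨
    g (move d a b)               ∎
    where
    open ≤-Reasoning
    E : List (Vector Bool n)
    E = map incident (possibleEdges n)
    k : ℕ
    k = d a ∸ suc (d b)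
    gap : Gap (toℤ d) k
    gap = cong +_ (≡.sym (≡.trans (+-suc (d b) k) (m+[n∸m]≡n db<da)))

g-cong : ∀ {d d′ : Vector ℕ n} → d ≗ d′ → g d ≡ g d′
g-cong {n} {d} {d′} d≗d′ = begin
  g d                                              ≡⟨ g≡ways d ⟩
  ways (map incident (possibleEdges n)) (toℤ d)    ≡⟨ ways-cong (map incident (possibleEdges n)) (cong +_ ∘ d≗d′) ⟩
  ways (map incident (possibleEdges n)) (toℤ d′)   ≡⟨ g≡ways d′ ⟨
  g d′                                             ∎
  where open ≡-Reasoning

sum-tabulate-mono : ∀ {f h : Vector ℕ n} → (∀ v → f v ≤ h v) → sum (tabulate f) ≤ sum (tabulate h)
sum-tabulate-mono {zero}  f≤h = z≤n
sum-tabulate-mono {suc n} f≤h = +-mono-≤ (f≤h zero) (sum-tabulate-mono (f≤h ∘ suc))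

sum-tabulate-< : ∀ {f h : Vector ℕ n} → (∀ v → f v ≤ h v) → ∀ i → f i < h i →
                 sum (tabulate f) < sum (tabulate h)
sum-tabulate-< f≤h zero    fi<hi = +-mono-<-≤ fi<hi (sum-tabulate-mono (f≤h ∘ suc))
sum-tabulate-< f≤h (suc i) fi<hi = +-mono-≤-< (f≤h zero) (sum-tabulate-< (f≤h ∘ suc) i fi<hi)

sum-tabulate-cong : ∀ {f h : Vector ℕ n} → f ≗ h → sum (tabulate f) ≡ sum (tabulate h)
sum-tabulate-cong f≗h = cong sum (tabulate-cong f≗h)

sum-updateAt-suc : ∀ (f : Vector ℕ n) i → sum (tabulate (updateAt f i suc)) ≡ suc (sum (tabulate f))
sum-updateAt-suc {suc n} f zero    = ≡.refl
sum-updateAt-suc {suc n} f (suc i) = ≡.trans (cong (_+_ (f zero)) (sum-updateAt-suc (f ∘ suc) i)) (+-suc (f zero) _)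

sum-updateAt-pred : ∀ (f : Vector ℕ n) i → 0 < f i → suc (sum (tabulate (updateAt f i pred))) ≡ sum (tabulate f)
sum-updateAt-pred {suc n} f zero    0<f0 = cong (_+ sum (tabulate (f ∘ suc))) (suc-pred (f zero) {{>-nonZero 0<f0}})
sum-updateAt-pred {suc n} f (suc i) 0<fi =
  ≡.trans (≡.sym (+-suc (f zero) _)) (cong (_+_ (f zero)) (sum-updateAt-pred (f ∘ suc) i 0<fi))

degSum-move : ∀ (d : Vector ℕ n) {a b} → a ≢ b → 0 < d a → degSum (move d a b) ≡ degSum d
degSum-move d {a} {b} a≢b 0<da = ≡.trans (sum-updateAt-suc (updateAt d a pred) b) (sum-updateAt-pred d a 0<da)

pred-∸ : ∀ m n → pred m ∸ n ≡ pred (m ∸ n)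
pred-∸ zero    n = ≡.trans (0∸n≡0 n) (cong pred (≡.sym (0∸n≡0 n)))
pred-∸ (suc m) n = ≡.sym (pred[m∸n]≡m∸[1+n] (suc m) n)

module Balancing (dhat : Vector ℕ n) (balanced : Balanced dhat) where

  excess : Vector ℕ n → ℕ
  excess d = sum (tabulate (λ v → d v ∸ dhat v))

  excess-move : ∀ d {a b} → a ≢ b → dhat a < d a → d b < dhat b → suc (excess (move d a b)) ≡ excess d
  excess-move d {a} {b} a≢b dhata<da db<dhatb =
    ≡.trans (cong suc (sum-tabulate-cong lowered)) (sum-updateAt-pred ε a (m<n⇒0<n∸m dhata<da))
    where
    open ≡-Reasoning
    open Transposition a b a≢b using (position; at-a; at-b; other)
    ε : Vector ℕ n
    ε v = d v ∸ dhat v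
    lowered : ∀ v → move d a b v ∸ dhat v ≡ updateAt ε a pred v
    lowered v with position v
    ... | at-a = begin
      move d a b a ∸ dhat a    ≡⟨ cong (_∸ dhat a) (move-a d a≢b) ⟩
      pred (d a) ∸ dhat a      ≡⟨ pred-∸ (d a) (dhat a) ⟩
      pred (ε a)               ≡⟨ updateAt-updates a ε ⟨
      updateAt ε a pred a      ∎
    ... | at-b = begin
      move d a b b ∸ dhat b    ≡⟨ cong (_∸ dhat b) (move-b d a≢b) ⟩
      suc (d b) ∸ dhat b       ≡⟨ m≤n⇒m∸n≡0 db<dhatb ⟩
      0                        ≡⟨ m≤n⇒m∸n≡0 (<⇒≤ db<dhatb) ⟨
      ε b                      ≡⟨ updateAt-minimal b a ε (a≢b ∘ ≡.sym) ⟨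
      updateAt ε a pred b      ∎
    ... | other v≢a v≢b = ≡.trans (cong (_∸ dhat v) (move-other d a≢b v≢a v≢b)) (≡.sym (updateAt-minimal v a ε v≢a))

  equal-or-unbalanced : ∀ d → degSum d ≡ degSum dhat →
                        d ≗ dhat ⊎ ∃[ a ] ∃[ b ] a ≢ b × dhat a < d a × d b < dhat b
  equal-or-unbalanced d d≡dhat with all? (λ v → d v ≤? dhat v)
  ... | yes d≤dhat = inj₁ (λ v → [ (λ dv<dhatv → ⊥-elim (<-irrefl d≡dhat (sum-tabulate-< d≤dhat v dv<dhatv))) , id ]′
                                  (m≤n⇒m<n∨m≡n (d≤dhat v)))
  ... | no d≰dhat with a , da≰dhata ← ¬∀⟶∃¬ n _ (λ v → d v ≤? dhat v) d≰dhat
                  with all? (λ v → dhat v ≤? d v)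
  ...   | yes dhat≤d = ⊥-elim (<-irrefl (≡.sym d≡dhat) (sum-tabulate-< dhat≤d a (≰⇒> da≰dhata)))
  ...   | no dhat≰d with b , dhatb≰db ← ¬∀⟶∃¬ n _ (λ v → dhat v ≤? d v) dhat≰d
                    = inj₂ (a , b , a≢b , ≰⇒> da≰dhata , ≰⇒> dhatb≰db)
    where
    a≢b : a ≢ b
    a≢b ≡.refl = <-asym (≰⇒> da≰dhata) (≰⇒> dhatb≰db)

  balance : ∀ k d → excess d ≡ k → degSum d ≡ degSum dhat → g d ≤ g dhat
  balance k d excess≡k d≡dhat with equal-or-unbalanced d d≡dhat
  ... | inj₁ d≗dhat = ≤-reflexive (g-cong d≗dhat)
  ... | inj₂ (a , b , a≢b , dhata<da , db<dhatb) with k | ≡.trans (excess-move d a≢b dhata<da db<dhatb) excess≡k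
  ...   | suc k′ | suc-excess≡ =
    ≤-trans (g-move d a≢b db<da) (balance k′ (move d a b) (suc-injective suc-excess≡) moved≡dhat)
    where
    db<da : d b < d a
    db<da = ≤-trans db<dhatb (≤-trans (balanced b a) dhata<da)
    moved≡dhat : degSum (move d a b) ≡ degSum dhat
    moved≡dhat = ≡.trans (degSum-move d a≢b (≤-trans (s≤s z≤n) db<da)) d≡dhat

lemma2 : (n m : ℕ) → n ≥ 1 → 1 ≤ m → m ≤ n C 2 →
    (dhat : Fin n → ℕ) → Balanced dhat → degSum dhat ≡ 2 * m →
    (d : Fin n → ℕ) → degSum d ≡ 2 * m →
    g d ≤ g dhat
lemma2 n m _ _ _ dhat balanced sum-dhat d sum-d = balance (excess d) d ≡.refl (≡.trans sum-d (≡.sym sum-dhat))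
  where open Balancing dhat balanced
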